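{- Let $p$ be a prime and let $A(x),B(x)\in\mathbb{Z}[x]$ be monic polynomials, coprime in $\mathbb{Q}[x]$, of degrees $d$ and $e$, such that both are split with simple roots modulo $p$. Let $p^\omega$ be the largest power of $p$ dividing some value $\gcd(A(n),B(n))$, $n\in\mathbb{Z}$. Let $r_1,\dots,r_d\in\mathbb{Z}$ be pairwise distinct modulo $p$ with $A(x)\equiv(x-r_1)\cdots(x-r_d)\pmod{p^\omega}$, and let $s_1,\dots,s_e\in\mathbb{Z}$ be pairwise distinct modulo $p$ with $B(x)\equiv(x-s_1)\cdots(x-s_e)\pmod{p^\omega}$ (congruences of polynomials, i.e. coefficientwise). Let $n\in\mathbb{Z}$. If there exist $1\le i\le d$ and $1\le j\le e$ with $n\equiv r_i\equiv s_j\pmod p$, then $$\gcd\big(A(n),B(n),p^\omega\big)=\gcd\big(n-r_i,\;r_i-s_j,\;p^\omega\big).$$ Otherwise $\gcd(A(n),B(n),p^\omega)=1$.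
   Context: A monic polynomial $A(x)\in\mathbb{Z}[x]$ is split with simple roots modulo $p$ if its reduction in $(\mathbb{Z}/p\mathbb{Z})[x]$ factors as $(x-\rho_1)\cdots(x-\rho_d)$ with $\rho_1,\dots,\rho_d$ pairwise distinct in $\mathbb{Z}/p\mathbb{Z}$. (By Hensel's lemma such a factorization lifts modulo any power of $p$, so integers $r_i$, $s_j$ as in the statement exist.) -}

module Defs where

open import Data.Nat as ℕ using (ℕ; zero; suc)
open import Data.Nat.GCD renaming (gcd to gcdℕ) using ()
open import Data.Integer as ℤ using (ℤ; +_; ∣_∣)
open import Data.Integer.Divisibility as ℤD using ()
open import Data.Rational as ℚ using (ℚ)
open import Data.List using (List; []; _∷_; map; foldr; length)
open import Data.Fin using (Fin)
open import Data.List using (allFin)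
open import Data.Product using (Σ; ∃; _×_; _,_)
open import Relation.Binary.PropositionalEquality using (_≡_; _≢_)
open import Relation.Nullary using (¬_)

-- Dense univariate polynomials as little-endian coefficient lists
-- (coefficient of x^k is the k-th entry; missing entries are 0).
-- Generic operations over a carrier with ring operations.
module PolyOps {A : Set} (0# 1# : A) (_+_ _*_ : A → A → A) (-_ : A → A) where

  Poly : Set
  Poly = List A

  _⊕_ : Poly → Poly → Poly
  [] ⊕ q = q
  (a ∷ p) ⊕ [] = a ∷ p
  (a ∷ p) ⊕ (b ∷ q) = (a + b) ∷ (p ⊕ q)

  scale : A → Poly → Poly
  scale c = map (c *_)

  _⊗_ : Poly → Poly → Poly
  [] ⊗ q = []
  (a ∷ p) ⊗ q = scale a q ⊕ (0# ∷ (p ⊗ q))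

  coeff : Poly → ℕ → A
  coeff [] k = 0#
  coeff (a ∷ p) zero = a
  coeff (a ∷ p) (suc k) = coeff p k

  eval : Poly → A → A
  eval [] x = 0#
  eval (a ∷ p) x = a + (x * eval p x)

  one : Poly
  one = 1# ∷ []

  linear : A → Poly
  linear r = (- r) ∷ 1# ∷ []

  prodLinear : {d : ℕ} → (Fin d → A) → Poly
  prodLinear {d} r = foldr (λ i acc → linear (r i) ⊗ acc) one (allFin d)

  -- polynomial equality (coefficientwise, ignoring trailing zeros)
  _≈P_ : Poly → Poly → Set
  p ≈P q = ∀ k → coeff p k ≡ coeff q k

module ℤP = PolyOps (+ 0) (+ 1) ℤ._+_ ℤ._*_ ℤ.-_
module ℚP = PolyOps ℚ.0ℚ ℚ.1ℚ ℚ._+_ ℚ._*_ ℚ.-_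

open ℤP using (coeff; eval; prodLinear) public

ZPoly : Set
ZPoly = ℤP.Poly

_≡_[mod_] : ℤ → ℤ → ℕ → Set
a ≡ b [mod m ] = (+ m) ℤD.∣ (a ℤ.- b)

_≡ₚ_[mod_] : ℤP.Poly → ℤP.Poly → ℕ → Set
P ≡ₚ Q [mod m ] = ∀ k → coeff P k ≡ coeff Q k [mod m ]

MonicOfDegree : ℤP.Poly → ℕ → Set
MonicOfDegree P d = (length P ≡ suc d) × (coeff P d ≡ + 1)

PairwiseDistinctMod : {d : ℕ} → ℕ → (Fin d → ℤ) → Set
PairwiseDistinctMod p r = ∀ i j → r i ≡ r j [mod p ] → i ≡ j

SplitSimpleMod : ℕ → ℤP.Poly → ℕ → Set
SplitSimpleMod p P d =
  Σ (Fin d → ℤ) λ ρ → PairwiseDistinctMod p ρ × (P ≡ₚ prodLinear ρ [mod p ])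

toℚP : ℤP.Poly → ℚP.Poly
toℚP = map (λ a → a ℚ./ 1)

-- coprime in ℚ[x] (ℚ[x] is a PID: the ideal (A,B) is the whole ring)
CoprimeOverℚ : ℤP.Poly → ℤP.Poly → Set
CoprimeOverℚ P Q =
  Σ ℚP.Poly λ U → Σ ℚP.Poly λ V →
    ((U ℚP.⊗ toℚP P) ℚP.⊕ (V ℚP.⊗ toℚP Q)) ℚP.≈P ℚP.one

gcdVal : ℤP.Poly → ℤP.Poly → ℤ → ℕ
gcdVal P Q n = gcdℕ ∣ eval P n ∣ ∣ eval Q n ∣

gcd3 : ℤ → ℤ → ℤ → ℕ
gcd3 a b c = gcdℕ (gcdℕ ∣ a ∣ ∣ b ∣) ∣ c ∣

-- Modulo p^ω, A(n) ≡ ∏ₖ (n - rₖ). If n ≡ rᵢ (mod p), every other factor n - rₖ is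
-- prime to p because the rₖ are distinct mod p, so a divisor of p^ω divides A(n) exactly
-- when it divides n - rᵢ; likewise B(n) and n - sⱼ. The common divisors of n - rᵢ, n - sⱼ
-- are those of n - rᵢ, rᵢ - sⱼ. Without a common root mod p, n is not a root mod p of one
-- of A, B, and the value of that polynomial at n is prime to p, hence to p^ω.
module Submission where

open import Defs
open import Data.Nat using (ℕ; suc; _^_)
open import Data.Nat.Divisibility using (_∣_)
open import Data.Nat.Primality using (Prime)
open import Data.Integer using (ℤ; +_; _-_)
open import Data.Fin using (Fin)
open import Data.Product using (∃; Σ; _×_)
open import Relation.Binary.PropositionalEquality using (_≡_)
open import Relation.Nullary using (¬_)

import Data.Nat as ℕ
import Data.Nat.Properties as ℕ
import Data.Nat.Divisibility as ℕ
open import Data.Nat.Primality using (euclidsLemma; prime⇒irreducible; ¬prime[1])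
open import Data.Nat.Coprimality using (Coprime; coprime-divisor)
open import Data.Nat.GCD using (gcd; gcd[m,n]∣m; gcd[m,n]∣n; gcd-greatest)
open import Data.Integer using (_+_; _*_)
import Data.Integer as ℤ
import Data.Integer.Properties as ℤ
import Data.Integer.Divisibility.Signed as Signed
open Signed using () renaming (_∣_ to _∣ᶻ_)
open import Data.Integer.Solver using (module +-*-Solver)
open +-*-Solver using (solve; _:+_; _:-_; _:*_; :-_; _:=_; con)
open import Data.Fin using (zero; suc; punchIn)
open import Data.Fin.Properties using (any?; punchInᵢ≢i)
open import Data.List using ([]; _∷_; foldr; tabulate)
open import Data.Product using (_,_)
open import Data.Product.Function.NonDependent.Propositional using (_×-⇔_)
open import Data.Sum using (inj₁; inj₂)
open import Data.Empty using (⊥-elim)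
open import Function using (_∘_; _⇔_; mk⇔; Equivalence)
import Function.Properties.Equivalence as ⇔
open import Relation.Nullary using (yes; no)
open import Relation.Binary.PropositionalEquality using (refl; sym; subst; _≢_)

open ℤP using (_⊕_; _⊗_; scale; one; linear)
open import Algebra.Properties.CommutativeMonoid.Sum ℤ.*-1-commutativeMonoid
  using () renaming (sum to ∏; sum-remove to ∏-remove)

eval-⊕ : ∀ P Q x → eval (P ⊕ Q) x ≡ eval P x + eval Q x
eval-⊕ []      Q       x = sym (ℤ.+-identityˡ (eval Q x))
eval-⊕ (a ∷ P) []      x = sym (ℤ.+-identityʳ _)
eval-⊕ (a ∷ P) (b ∷ Q) x rewrite eval-⊕ P Q x =
  solve 5 (λ a b x u v → (a :+ b) :+ x :* (u :+ v) := (a :+ x :* u) :+ (b :+ x :* v))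
    refl a b x (eval P x) (eval Q x)

eval-scale : ∀ c Q x → eval (scale c Q) x ≡ c * eval Q x
eval-scale c []      x = sym (ℤ.*-zeroʳ c)
eval-scale c (b ∷ Q) x rewrite eval-scale c Q x =
  solve 4 (λ c b x v → c :* b :+ x :* (c :* v) := c :* (b :+ x :* v)) refl c b x (eval Q x)

eval-⊗ : ∀ P Q x → eval (P ⊗ Q) x ≡ eval P x * eval Q x
eval-⊗ []      Q x = refl
eval-⊗ (a ∷ P) Q x
  rewrite eval-⊕ (scale a Q) (+ 0 ∷ (P ⊗ Q)) x | eval-scale a Q x | eval-⊗ P Q x =
  solve 4 (λ a x u v → a :* v :+ (con (+ 0) :+ x :* (u :* v)) := (a :+ x :* u) :* v)
    refl a x (eval P x) (eval Q x)

eval-linear : ∀ r x → eval (linear r) x ≡ x - r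
eval-linear r x =
  solve 2 (λ r x → (:- r) :+ x :* (con (+ 1) :+ x :* con (+ 0)) := x :- r) refl r x

eval-foldr-linear : ∀ {D} (r : Fin D → ℤ) {d} (g : Fin d → Fin D) x →
  eval (foldr (λ i acc → linear (r i) ⊗ acc) one (tabulate g)) x ≡ ∏ (λ k → x - r (g k))
eval-foldr-linear r {ℕ.zero} g x = solve 1 (λ x → con (+ 1) :+ x :* con (+ 0) := con (+ 1)) refl x
eval-foldr-linear r {ℕ.suc d} g x
  rewrite eval-⊗ (linear (r (g zero)))
                 (foldr (λ i acc → linear (r i) ⊗ acc) one (tabulate (g ∘ suc))) x
        | eval-linear (r (g zero)) x
        | eval-foldr-linear r (g ∘ suc) x = refl

eval-prodLinear : ∀ {d} (r : Fin d → ℤ) x → eval (prodLinear r) x ≡ ∏ (λ k → x - r k)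
eval-prodLinear r = eval-foldr-linear r (λ k → k)

≡-mod-sym : ∀ a b {m} → a ≡ b [mod m ] → b ≡ a [mod m ]
≡-mod-sym a b = subst (_ ∣_) (ℤ.∣i-j∣≡∣j-i∣ a b)

≡-mod-trans : ∀ a b c {m} → a ≡ b [mod m ] → b ≡ c [mod m ] → a ≡ c [mod m ]
≡-mod-trans a b c {m} a≡b b≡c = Signed.∣⇒∣ᵤ (subst (+ m ∣ᶻ_)
  (solve 3 (λ a b c → (a :- b) :+ (b :- c) := a :- c) refl a b c)
  (Signed.∣m∣n⇒∣m+n {+ m} {a - b} {b - c} (Signed.∣ᵤ⇒∣ a≡b) (Signed.∣ᵤ⇒∣ b≡c)))

≡-mod-∣⇒∣ : ∀ a b {k} → a ≡ b [mod k ] → k ∣ ℤ.∣ a ∣ → k ∣ ℤ.∣ b ∣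
≡-mod-∣⇒∣ a b {k} a≡b k∣a = Signed.∣⇒∣ᵤ (subst (+ k ∣ᶻ_)
  (solve 2 (λ a b → a :- (a :- b) := b) refl a b)
  (Signed.∣m∣n⇒∣m-n {+ k} {a} {a - b} (Signed.∣ᵤ⇒∣ k∣a) (Signed.∣ᵤ⇒∣ a≡b)))

≡-mod⇒∣⇔∣ : ∀ a b {k} → a ≡ b [mod k ] → (k ∣ ℤ.∣ a ∣) ⇔ (k ∣ ℤ.∣ b ∣)
≡-mod⇒∣⇔∣ a b a≡b = mk⇔ (≡-mod-∣⇒∣ a b a≡b) (≡-mod-∣⇒∣ b a (≡-mod-sym a b a≡b))

≡-mod-common⇔ : ∀ n a b {k} →
  (n ≡ a [mod k ] × n ≡ b [mod k ]) ⇔ (n ≡ a [mod k ] × a ≡ b [mod k ])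
≡-mod-common⇔ n a b = mk⇔
  (λ (n≡a , n≡b) → n≡a , ≡-mod-trans a n b (≡-mod-sym n a n≡a) n≡b)
  (λ (n≡a , a≡b) → n≡a , ≡-mod-trans n a b n≡a a≡b)

eval-cong : ∀ {m} P Q → P ≡ₚ Q [mod m ] → ∀ x → eval P x ≡ eval Q x [mod m ]
eval-cong {m} P Q P≡Q x = Signed.∣⇒∣ᵤ (go P Q (Signed.∣ᵤ⇒∣ ∘ P≡Q))
  where
  -- [] is treated as 0 ∷ [], whose coefficients and value agree with those of [].
  eval[] : eval [] x ≡ + 0 + x * eval [] x
  eval[] = solve 1 (λ x → con (+ 0) := con (+ 0) :+ x :* con (+ 0)) refl x

  step : ∀ a b u v → + m ∣ᶻ a - b → + m ∣ᶻ u - v → + m ∣ᶻ (a + x * u) - (b + x * v)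
  step a b u v m∣a-b m∣u-v = subst (+ m ∣ᶻ_)
    (solve 5 (λ a b x u v → (a :- b) :+ x :* (u :- v) := (a :+ x :* u) :- (b :+ x :* v)) refl a b x u v)
    (Signed.∣m∣n⇒∣m+n {+ m} {a - b} {x * (u - v)} m∣a-b (Signed.∣n⇒∣m*n x m∣u-v))

  go : ∀ P Q → (∀ k → + m ∣ᶻ coeff P k - coeff Q k) → + m ∣ᶻ eval P x - eval Q x
  go []      []      h = h 0
  go []      (b ∷ Q) h = subst (λ z → + m ∣ᶻ z - eval (b ∷ Q) x) (sym eval[])
    (step (+ 0) b (eval [] x) (eval Q x) (h 0) (go [] Q (h ∘ suc)))
  go (a ∷ P) []      h = subst (λ z → + m ∣ᶻ eval (a ∷ P) x - z) (sym eval[])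
    (step a (+ 0) (eval P x) (eval [] x) (h 0) (go P [] (h ∘ suc)))
  go (a ∷ P) (b ∷ Q) h = step a b (eval P x) (eval Q x) (h 0) (go P Q (h ∘ suc))

prime∤∏ : ∀ {p} → Prime p → ∀ {d} (f : Fin d → ℤ) → (∀ k → ¬ p ∣ ℤ.∣ f k ∣) → ¬ p ∣ ℤ.∣ ∏ f ∣
prime∤∏ p-prime {ℕ.zero}  f p∤f p∣1 with ℕ.∣1⇒≡1 p∣1
... | refl = ¬prime[1] p-prime
prime∤∏ p-prime {ℕ.suc d} f p∤f p∣∏
  with euclidsLemma _ _ p-prime (subst (_ ∣_) (ℤ.abs-* (f zero) (∏ (f ∘ suc))) p∣∏)
... | inj₁ p∣f₀ = p∤f zero p∣f₀
... | inj₂ p∣∏ₜ = prime∤∏ p-prime (f ∘ suc) (p∤f ∘ suc) p∣∏ₜ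

coprime-^ : ∀ {p u} → Prime p → ¬ p ∣ u → ∀ ω → Coprime u (p ^ ω)
coprime-^ p-prime p∤u ℕ.zero    (_ , c∣1) = ℕ.∣1⇒≡1 c∣1
coprime-^ {p} p-prime p∤u (ℕ.suc ω) {c} (c∣u , c∣pp^ω) =
  coprime-^ p-prime p∤u ω (c∣u , coprime-divisor c⊥p c∣pp^ω)
  where
  c⊥p : Coprime c p
  c⊥p (b∣c , b∣p) with prime⇒irreducible p-prime b∣p
  ... | inj₁ b≡1 = b≡1
  ... | inj₂ refl = ⊥-elim (p∤u (ℕ.∣-trans b∣c c∣u))

coprime⇒∣*⇔∣ : ∀ {k u v} → Coprime k u → (k ∣ v ℕ.* u) ⇔ (k ∣ v)
coprime⇒∣*⇔∣ {k} {u} {v} k⊥u =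
  mk⇔ (λ k∣vu → coprime-divisor k⊥u (subst (k ∣_) (ℕ.*-comm v u) k∣vu)) (ℕ.∣m⇒∣m*n u)

∣∏⇔∣ : ∀ {p} → Prime p → ∀ {d} (f : Fin d → ℤ) i → (∀ l → l ≢ i → ¬ p ∣ ℤ.∣ f l ∣) →
  ∀ ω {k} → k ∣ p ^ ω → (k ∣ ℤ.∣ ∏ f ∣) ⇔ (k ∣ ℤ.∣ f i ∣)
∣∏⇔∣ {p} p-prime {ℕ.suc d} f i p∤others ω {k} k∣p^ω
  rewrite ∏-remove {i = i} f | ℤ.abs-* (f i) (∏ (f ∘ punchIn i)) =
  coprime⇒∣*⇔∣ k⊥rest
  where
  rest⊥p^ω : Coprime ℤ.∣ ∏ (f ∘ punchIn i) ∣ (p ^ ω)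
  rest⊥p^ω = coprime-^ p-prime
    (prime∤∏ p-prime (f ∘ punchIn i) (λ l → p∤others (punchIn i l) (punchInᵢ≢i i l))) ω

  k⊥rest : Coprime k ℤ.∣ ∏ (f ∘ punchIn i) ∣
  k⊥rest (c∣k , c∣rest) = rest⊥p^ω (c∣rest , ℕ.∣-trans c∣k k∣p^ω)

module SplitModPrimePower {p} (p-prime : Prime p) (ω : ℕ) (P : ZPoly) {d} (r : Fin d → ℤ)
  (P≡∏ : P ≡ₚ prodLinear r [mod p ^ ω ]) where

  eval≡∏ : ∀ n → eval P n ≡ ∏ (λ k → n - r k) [mod p ^ ω ]
  eval≡∏ n = subst (λ z → eval P n ≡ z [mod p ^ ω ]) (eval-prodLinear r n)
    (eval-cong P (prodLinear r) P≡∏ n)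

  ∣eval⇔≡root : PairwiseDistinctMod p r → ∀ n i → n ≡ r i [mod p ] →
    ∀ {k} → k ∣ p ^ ω → (k ∣ ℤ.∣ eval P n ∣) ⇔ (n ≡ r i [mod k ])
  ∣eval⇔≡root r-distinct n i n≡rᵢ k∣p^ω =
    ⇔.trans (≡-mod⇒∣⇔∣ (eval P n) (∏ (λ l → n - r l)) (ℕ.∣-trans k∣p^ω (eval≡∏ n)))
            (∣∏⇔∣ p-prime (λ l → n - r l) i n≢rₗ ω k∣p^ω)
    where
    n≢rₗ : ∀ l → l ≢ i → ¬ n ≡ r l [mod p ]
    n≢rₗ l l≢i n≡rₗ = l≢i (r-distinct l i (≡-mod-trans (r l) n (r i) (≡-mod-sym n (r l) n≡rₗ) n≡rᵢ))

  eval-coprime : ∀ {n} → (∀ i → ¬ n ≡ r i [mod p ]) → Coprime ℤ.∣ eval P n ∣ (p ^ ω)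
  eval-coprime {n} n≢r (c∣P , c∣p^ω) =
    ∏⊥p^ω (≡-mod-∣⇒∣ (eval P n) (∏ (λ k → n - r k)) (ℕ.∣-trans c∣p^ω (eval≡∏ n)) c∣P , c∣p^ω)
    where
    ∏⊥p^ω : Coprime ℤ.∣ ∏ (λ k → n - r k) ∣ (p ^ ω)
    ∏⊥p^ω = coprime-^ p-prime (prime∤∏ p-prime (λ k → n - r k) n≢r) ω

gcd3-divisors : ∀ x y m →
  (gcd3 x y (+ m) ∣ ℤ.∣ x ∣) × (gcd3 x y (+ m) ∣ ℤ.∣ y ∣) × (gcd3 x y (+ m) ∣ m)
gcd3-divisors x y m =
  ℕ.∣-trans g∣gcd[x,y] (gcd[m,n]∣m ℤ.∣ x ∣ ℤ.∣ y ∣) ,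
  ℕ.∣-trans g∣gcd[x,y] (gcd[m,n]∣n ℤ.∣ x ∣ ℤ.∣ y ∣) ,
  gcd[m,n]∣n (gcd ℤ.∣ x ∣ ℤ.∣ y ∣) m
  where
  g∣gcd[x,y] : gcd3 x y (+ m) ∣ gcd ℤ.∣ x ∣ ℤ.∣ y ∣
  g∣gcd[x,y] = gcd[m,n]∣m (gcd ℤ.∣ x ∣ ℤ.∣ y ∣) m

gcd3-cong : ∀ x y x′ y′ {m} →
  (∀ {k} → k ∣ m → ((k ∣ ℤ.∣ x ∣) × (k ∣ ℤ.∣ y ∣)) ⇔ ((k ∣ ℤ.∣ x′ ∣) × (k ∣ ℤ.∣ y′ ∣))) →
  gcd3 x y (+ m) ≡ gcd3 x′ y′ (+ m)
gcd3-cong x y x′ y′ {m} same = ℕ.∣-antisym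
  (gcd3∣gcd3 x y x′ y′ (Equivalence.to ∘ same))
  (gcd3∣gcd3 x′ y′ x y (Equivalence.from ∘ same))
  where
  gcd3∣gcd3 : ∀ a b a′ b′ →
    (∀ {k} → k ∣ m → (k ∣ ℤ.∣ a ∣) × (k ∣ ℤ.∣ b ∣) → (k ∣ ℤ.∣ a′ ∣) × (k ∣ ℤ.∣ b′ ∣)) →
    gcd3 a b (+ m) ∣ gcd3 a′ b′ (+ m)
  gcd3∣gcd3 a b a′ b′ to with gcd3-divisors a b m
  ... | g∣a , g∣b , g∣m with to g∣m (g∣a , g∣b)
  ... | g∣a′ , g∣b′ = gcd-greatest (gcd-greatest g∣a′ g∣b′) g∣m

gcd3-coprimeˡ : ∀ x y {m} → Coprime ℤ.∣ x ∣ m → gcd3 x y (+ m) ≡ 1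
gcd3-coprimeˡ x y {m} x⊥m with gcd3-divisors x y m
... | g∣x , _ , g∣m = x⊥m (g∣x , g∣m)

gcd3-coprimeʳ : ∀ x y {m} → Coprime ℤ.∣ y ∣ m → gcd3 x y (+ m) ≡ 1
gcd3-coprimeʳ x y {m} y⊥m with gcd3-divisors x y m
... | _ , g∣y , g∣m = y⊥m (g∣y , g∣m)

theorem11 : (p : ℕ) → Prime p →
    (A B : ZPoly) → (d e : ℕ) →
    MonicOfDegree A d → MonicOfDegree B e →
    CoprimeOverℚ A B →
    SplitSimpleMod p A d → SplitSimpleMod p B e →
    (ω : ℕ) →
    (∃ λ (n : ℤ) → (p ^ ω) ∣ gcdVal A B n) →
    (∀ (n : ℤ) → ¬ ((p ^ suc ω) ∣ gcdVal A B n)) →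
    (r : Fin d → ℤ) → PairwiseDistinctMod p r → A ≡ₚ prodLinear r [mod p ^ ω ] →
    (s : Fin e → ℤ) → PairwiseDistinctMod p s → B ≡ₚ prodLinear s [mod p ^ ω ] →
    (n : ℤ) →
    ((i : Fin d) → (j : Fin e) → n ≡ r i [mod p ] → r i ≡ s j [mod p ] →
       gcd3 (eval A n) (eval B n) (+ (p ^ ω)) ≡ gcd3 (n - r i) (r i - s j) (+ (p ^ ω)))
    ×
    (¬ (Σ (Fin d) λ i → Σ (Fin e) λ j → (n ≡ r i [mod p ]) × (r i ≡ s j [mod p ])) →
       gcd3 (eval A n) (eval B n) (+ (p ^ ω)) ≡ 1)
theorem11 p p-prime A B d e _ _ _ _ _ ω _ _ r r-distinct A≡∏ s s-distinct B≡∏ n =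
  common-root , no-common-root
  where
  module A′ = SplitModPrimePower p-prime ω A r A≡∏
  module B′ = SplitModPrimePower p-prime ω B s B≡∏

  common-root : ∀ i j → n ≡ r i [mod p ] → r i ≡ s j [mod p ] →
    gcd3 (eval A n) (eval B n) (+ (p ^ ω)) ≡ gcd3 (n - r i) (r i - s j) (+ (p ^ ω))
  common-root i j n≡rᵢ rᵢ≡sⱼ =
    gcd3-cong (eval A n) (eval B n) (n - r i) (r i - s j) λ k∣p^ω → ⇔.trans
      (A′.∣eval⇔≡root r-distinct n i n≡rᵢ k∣p^ω
        ×-⇔ B′.∣eval⇔≡root s-distinct n j (≡-mod-trans n (r i) (s j) n≡rᵢ rᵢ≡sⱼ) k∣p^ω)
      (≡-mod-common⇔ n (r i) (s j))

  no-common-root : ¬ (Σ (Fin d) λ i → Σ (Fin e) λ j → (n ≡ r i [mod p ]) × (r i ≡ s j [mod p ])) →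
    gcd3 (eval A n) (eval B n) (+ (p ^ ω)) ≡ 1
  no-common-root no-ij with any? (λ i → p ℕ.∣? ℤ.∣ n - r i ∣)
  ... | no no-i =
    gcd3-coprimeˡ (eval A n) (eval B n) (A′.eval-coprime λ i n≡rᵢ → no-i (i , n≡rᵢ))
  ... | yes (i , n≡rᵢ) =
    gcd3-coprimeʳ (eval A n) (eval B n) (B′.eval-coprime λ j n≡sⱼ →
      no-ij (i , j , n≡rᵢ , ≡-mod-trans (r i) n (s j) (≡-mod-sym n (r i) n≡rᵢ) n≡sⱼ))
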